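{- The system $\mathbf{M}^\Delta$ (axiomatized by TAUT, $\Delta$Equ, $\Delta$M and the rules modus ponens and RE$\Delta$) is sound and strongly complete with respect to the class of all neighborhood frames satisfying $(s)$.
   Context: The language $\mathcal{L}(\Delta)$ is given by $\phi::=p\mid\neg\phi\mid\phi\land\phi\mid\Delta\phi$ with $p$ ranging over a fixed countably infinite set $\mathbf{P}$ of propositional variables; $\vee,\to,\leftrightarrow,\top$ are the usual abbreviations. A neighborhood model is $\mathcal{M}=\langle S,N,V\rangle$ with $S\neq\emptyset$, $N:S\to\mathcal{P}(\mathcal{P}(S))$ and $V:\mathbf{P}\to\mathcal{P}(S)$; $\langle S,N\rangle$ is a frame. Truth: $\mathcal{M},s\vDash p$ iff $s\in V(p)$; Boolean clauses as usual; $\mathcal{M},s\vDash\Delta\phi$ iff $\phi^{\mathcal{M}}\in N(s)$ or $S\setminus\phi^{\mathcal{M}}\in N(s)$, where $\phi^{\mathcal{M}}=\{s\in S\mid \mathcal{M},s\vDash\phi\}$. A frame satisfies $(s)$ if for every $s\in S$, $X\in N(s)$ and $X\subseteq Y\subseteq S$ imply $Y\in N(s)$. Axioms/rules: TAUT (all instances of propositional tautologies), $\Delta$Equ: $\Delta\phi\leftrightarrow\Delta\neg\phi$; $\Delta$M: $\Delta\phi\to\Delta(\phi\vee\psi)\vee\Delta(\neg\phi\vee\chi)$; RE$\Delta$: from $\phi\leftrightarrow\psi$ infer $\Delta\phi\leftrightarrow\Delta\psi$; plus modus ponens. Soundness: every theorem is valid on every frame of the class. Strong completeness: for every set $\Gamma$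 of formulas and formula $\phi$, if $\phi$ is true at every state of every model based on a frame in the class at which all of $\Gamma$ is true, then $\phi$ is derivable from $\Gamma$ in the system. -}

module Defs where

open import Level using (Level; 0ℓ) renaming (suc to lsuc)
open import Data.Nat using (ℕ)
open import Data.Bool using (Bool; true; false; not; _∧_; _∨_)
open import Data.List using (List; []; _∷_)
open import Data.List.Relation.Unary.All using (All)
open import Data.Product using (Σ; _×_; ∃; _,_)
open import Relation.Binary.PropositionalEquality using (_≡_)

infixr 6 _∧ᶠ_
infixr 5 _∨ᶠ_
infixr 4 _⇒_ _⇔_

data Form : Set where
  var   : ℕ → Form
  ~_    : Form → Form
  _∧ᶠ_  : Form → Form → Form
  Δ     : Form → Form

_∨ᶠ_ : Form → Form → Form
φ ∨ᶠ ψ = ~ (~ φ ∧ᶠ ~ ψ)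

_⇒_ : Form → Form → Form
φ ⇒ ψ = ~ (φ ∧ᶠ ~ ψ)

_⇔_ : Form → Form → Form
φ ⇔ ψ = (φ ⇒ ψ) ∧ᶠ (ψ ⇒ φ)

⊤ᶠ : Form
⊤ᶠ = var 0 ⇒ var 0

-- Propositional tautologies: formulas true under every Boolean
-- valuation that treats variables and Δ-formulas as atoms.
-- (Exactly the instances of propositional tautologies.)

evalPL : (Form → Bool) → Form → Bool
evalPL v (var p)  = v (var p)
evalPL v (~ φ)    = not (evalPL v φ)
evalPL v (φ ∧ᶠ ψ) = evalPL v φ ∧ evalPL v ψ
evalPL v (Δ φ)    = v (Δ φ)

Tautology : Form → Set
Tautology φ = (v : Form → Bool) → evalPL v φ ≡ true

data ⊢M_ : Form → Set where
  TAUT : ∀ {φ} → Tautology φ → ⊢M φ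
  ΔEqu : ∀ φ → ⊢M (Δ φ ⇔ Δ (~ φ))
  ΔM   : ∀ φ ψ χ → ⊢M (Δ φ ⇒ (Δ (φ ∨ᶠ ψ) ∨ᶠ Δ (~ φ ∨ᶠ χ)))
  MP   : ∀ {φ ψ} → ⊢M φ → ⊢M (φ ⇒ ψ) → ⊢M ψ
  REΔ  : ∀ {φ ψ} → ⊢M (φ ⇔ ψ) → ⊢M (Δ φ ⇔ Δ ψ)

⋀ : List Form → Form
⋀ []       = ⊤ᶠ
⋀ (φ ∷ φs) = φ ∧ᶠ ⋀ φs

_⊢_ : (Form → Set) → Form → Set
Γ ⊢ φ = Σ (List Form) λ ψs → All Γ ψs × ⊢M (⋀ ψs ⇒ φ)

-- Neighborhood frames and models.  Subsets of S are characteristic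
-- functions S → Bool (classical power set).

record Frame (ℓ : Level) : Set (lsuc ℓ) where
  field
    S   : Set ℓ
    s₀  : S                          -- S ≠ ∅
    N   : S → (S → Bool) → Bool

record Model (ℓ : Level) : Set (lsuc ℓ) where
  field
    frame : Frame ℓ
  open Frame frame public
  field
    V : ℕ → S → Bool

⟦_⟧ : ∀ {ℓ} {M : Model ℓ} → Form → Model.S M → Bool
⟦_⟧ {M = M} (var p)  s = Model.V M p s
⟦_⟧ {M = M} (~ φ)    s = not (⟦_⟧ {M = M} φ s)
⟦_⟧ {M = M} (φ ∧ᶠ ψ) s = ⟦_⟧ {M = M} φ s ∧ ⟦_⟧ {M = M} ψ s
⟦_⟧ {M = M} (Δ φ)    s =
  Model.N M s (⟦_⟧ {M = M} φ) ∨ Model.N M s (λ t → not (⟦_⟧ {M = M} φ t))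

_,_⊨_ : ∀ {ℓ} (M : Model ℓ) → Model.S M → Form → Set
M , s ⊨ φ = ⟦_⟧ {M = M} φ s ≡ true

Supplemented : ∀ {ℓ} → Frame ℓ → Set ℓ
Supplemented F = ∀ s (X Y : S → Bool) → N s X ≡ true
  → (∀ t → X t ≡ true → Y t ≡ true) → N s Y ≡ true
  where open Frame F

Sound : (ℓ : Level) → Set (lsuc ℓ)
Sound ℓ = ∀ φ → ⊢M φ → (M : Model ℓ) → Supplemented (Model.frame M)
  → ∀ s → M , s ⊨ φ

_⊨[_]_ : (Form → Set) → (ℓ : Level) → Form → Set (lsuc ℓ)
Γ ⊨[ ℓ ] φ = (M : Model ℓ) → Supplemented (Model.frame M)
  → ∀ s → (∀ ψ → Γ ψ → M , s ⊨ ψ) → M , s ⊨ φ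

StronglyComplete : (ℓ : Level) → Set (lsuc ℓ)
StronglyComplete ℓ = ∀ (Γ : Form → Set) φ → Γ ⊨[ ℓ ] φ → Γ ⊢ φ

-- Soundness: on a supplemented frame N(s) cannot tell apart sets with the same
-- elements, which validates REΔ and ΔEqu, and ΔM holds because N(s) is closed
-- under supersets.
--
-- Completeness: the canonical model consists of the maximal consistent sets,
-- and X is a neighbourhood of m iff X ⊇ |φ| for some φ with Δ(φ ∨ ψ) ∈ m for
-- every ψ; this is supplemented by construction. In the truth lemma, if Δφ ∈ m
-- then ΔM forces either Δ(φ ∨ ψ) ∈ m for all ψ or Δ(¬φ ∨ χ) ∈ m for all χ, so
-- |φ| or |¬φ| is a neighbourhood of m. Conversely a witness φ₀ with |φ₀| ⊆ |φ|
-- gives ⊢ φ₀ → φ, hence ⊢ Δ(φ₀ ∨ φ) ↔ Δφ by REΔ, so Δφ ∈ m (for |¬φ| use ΔEqu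
-- as well). Excluded middle is used for Lindenbaum's lemma and to decide
-- canonical neighbourhoods.
module Submission where

open import Defs
open import Level using (Level; 0ℓ; Lift; lift; lower)
open import Axiom.ExcludedMiddle using (ExcludedMiddle)
open import Data.Product using (_×_; Σ; ∃-syntax; _,_; proj₁; proj₂)
open import Data.Bool using (Bool; true; false; not; _∧_; _∨_)
open import Data.Bool.Properties
  using (∧-conicalˡ; ∧-conicalʳ; ∨-comm; not-involutive; ¬-not; not-¬)
  renaming (_≟_ to _≟ᵇ_)
open import Data.Empty using (⊥-elim)
open import Data.List using (List; []; _∷_; _++_)
open import Data.List.Relation.Unary.All as All using (All; []; _∷_)
open import Data.List.Relation.Unary.All.Properties using (++⁺; ++⁻ˡ; ++⁻ʳ)
open import Data.Nat using (ℕ; zero; suc; _≤′_; ≤′-refl; ≤′-step; _⊔_)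
open import Data.Nat.Properties using (m≤m⊔n; m≤n⊔m; ≤⇒≤′)
open import Data.Nat.Binary using (ℕᵇ; 2[1+_]; 1+[2_]; toℕ) renaming (zero to 0ᵇ)
open import Data.Nat.Binary.Properties
  using (toℕ-injective; 2[1+_]-injective; 1+[2_]-injective)
open import Data.Sum using (_⊎_; inj₁; inj₂; [_,_]′) renaming (map to ⊎-map)
open import Function using (_∘_; id)
open import Relation.Nullary using (¬_; Dec; yes; no; does)
open import Relation.Nullary.Decidable using (dec-true; decidable-stable; map′)
open import Relation.Unary using (Pred; _⊆_; _∪_; ｛_｝; ⋃; ∅)
open import Relation.Binary.PropositionalEquality
  using (_≡_; refl; sym; trans; cong; cong₂; module ≡-Reasoning)

private
  variable
    v : Form → Bool
    φ ψ : Form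
    Γ Θ : Pred Form 0ℓ

≡true-ext : ∀ {x y} → (x ≡ true → y ≡ true) → (y ≡ true → x ≡ true) → x ≡ y
≡true-ext {true}  {true}  _ _ = refl
≡true-ext {true}  {false} f _ = sym (f refl)
≡true-ext {false} {true}  _ g = g refl
≡true-ext {false} {false} _ _ = refl

∨-true⁻ : ∀ x {y} → x ∨ y ≡ true → x ≡ true ⊎ y ≡ true
∨-true⁻ true  _ = inj₁ refl
∨-true⁻ false e = inj₂ e

∨-true⁺ˡ : ∀ {x y} → x ≡ true → x ∨ y ≡ true
∨-true⁺ˡ refl = refl

dec-true⁻ : ∀ {P : Set} (p? : Dec P) → does p? ≡ true → P
dec-true⁻ (yes p) _ = p

does-∨≡ : ∀ {P Q : Set} (p? : Dec P) (q? : Dec Q) {b : Bool} →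
  (P ⊎ Q → b ≡ true) → (b ≡ true → P ⊎ Q) → does p? ∨ does q? ≡ b
does-∨≡ (yes p) _               to _    = sym (to (inj₁ p))
does-∨≡ (no _)  (yes q)         to _    = sym (to (inj₂ q))
does-∨≡ (no _)  (no _)  {false} _  _    = refl
does-∨≡ (no ¬p) (no ¬q) {true}  _  from = ⊥-elim ([ ¬p , ¬q ]′ (from refl))

infix 3 _⊩_ _∋_
infix 2 _⊨PL_

-- A record rather than evalPL v φ ≡ true, so that φ can be inferred from the
-- type even though evalPL unfolds the connectives.
record _⊩_ (v : Form → Bool) (φ : Form) : Set where
  constructor mk⊩
  field eval≡true : evalPL v φ ≡ true
open _⊩_

_⊩?_ : ∀ v φ → Dec (v ⊩ φ)
v ⊩? φ = map′ mk⊩ eval≡true (evalPL v φ ≟ᵇ true)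

⊩-stable : ¬ ¬ (v ⊩ φ) → v ⊩ φ
⊩-stable {v} {φ} = decidable-stable (v ⊩? φ)

⊩-~⁺ : ¬ (v ⊩ φ) → v ⊩ ~ φ
⊩-~⁺ ¬p = mk⊩ (sym (¬-not (λ e → ¬p (mk⊩ (sym e)))))

⊩-~⁻ : v ⊩ ~ φ → ¬ (v ⊩ φ)
⊩-~⁻ p q = not-¬ (sym (eval≡true q)) (sym (eval≡true p))

⊩-∧⁺ : v ⊩ φ → v ⊩ ψ → v ⊩ φ ∧ᶠ ψ
⊩-∧⁺ p q = mk⊩ (cong₂ _∧_ (eval≡true p) (eval≡true q))

⊩-∧⁻ : v ⊩ φ ∧ᶠ ψ → v ⊩ φ × v ⊩ ψ
⊩-∧⁻ (mk⊩ e) = mk⊩ (∧-conicalˡ _ _ e) , mk⊩ (∧-conicalʳ _ _ e)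

⊩-⇒⁺ : (v ⊩ φ → v ⊩ ψ) → v ⊩ φ ⇒ ψ
⊩-⇒⁺ h = ⊩-~⁺ λ p∧¬q → ⊩-~⁻ (proj₂ (⊩-∧⁻ p∧¬q)) (h (proj₁ (⊩-∧⁻ p∧¬q)))

⊩-⇒⁻ : v ⊩ φ ⇒ ψ → v ⊩ φ → v ⊩ ψ
⊩-⇒⁻ h p = ⊩-stable λ ¬q → ⊩-~⁻ h (⊩-∧⁺ p (⊩-~⁺ ¬q))

⊩-∨⁺ˡ : v ⊩ φ → v ⊩ φ ∨ᶠ ψ
⊩-∨⁺ˡ p = ⊩-~⁺ λ h → ⊩-~⁻ (proj₁ (⊩-∧⁻ h)) p

⊩-∨⁺ʳ : v ⊩ ψ → v ⊩ φ ∨ᶠ ψ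
⊩-∨⁺ʳ q = ⊩-~⁺ λ h → ⊩-~⁻ (proj₂ (⊩-∧⁻ h)) q

⊩-∨⁻ : v ⊩ φ ∨ᶠ ψ → v ⊩ φ ⊎ v ⊩ ψ
⊩-∨⁻ {v} {φ} h with v ⊩? φ
... | yes p = inj₁ p
... | no ¬p = inj₂ (⊩-stable λ ¬q → ⊩-~⁻ h (⊩-∧⁺ (⊩-~⁺ ¬p) (⊩-~⁺ ¬q)))

⊩-⇔⁻ : v ⊩ φ ⇔ ψ → evalPL v φ ≡ evalPL v ψ
⊩-⇔⁻ h = ≡true-ext (eval≡true ∘ ⊩-⇒⁻ (proj₁ (⊩-∧⁻ h)) ∘ mk⊩)
                   (eval≡true ∘ ⊩-⇒⁻ (proj₂ (⊩-∧⁻ h)) ∘ mk⊩)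

⊩-⇔⁺ : evalPL v φ ≡ evalPL v ψ → v ⊩ φ ⇔ ψ
⊩-⇔⁺ e = ⊩-∧⁺ (⊩-⇒⁺ λ p → mk⊩ (trans (sym e) (eval≡true p)))
              (⊩-⇒⁺ λ q → mk⊩ (trans e (eval≡true q)))

⊩-⊤ : v ⊩ ⊤ᶠ
⊩-⊤ = ⊩-⇒⁺ id

⊩-⋀⁺ : ∀ {l} → All (v ⊩_) l → v ⊩ ⋀ l
⊩-⋀⁺ []       = ⊩-⊤
⊩-⋀⁺ (p ∷ ps) = ⊩-∧⁺ p (⊩-⋀⁺ ps)

⊩-⋀⁻ : ∀ l → v ⊩ ⋀ l → All (v ⊩_) l
⊩-⋀⁻ []      _ = []
⊩-⋀⁻ (_ ∷ l) p = proj₁ (⊩-∧⁻ p) ∷ ⊩-⋀⁻ l (proj₂ (⊩-∧⁻ p))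

_⊨PL_ : List Form → Form → Set
ψs ⊨PL φ = ∀ v → All (v ⊩_) ψs → v ⊩ φ

⊢M-⊨PL : ∀ {ψs} → All ⊢M_ ψs → ψs ⊨PL φ → ⊢M φ
⊢M-⊨PL []       h = TAUT λ v → eval≡true (h v [])
⊢M-⊨PL (d ∷ ds) h = MP d (⊢M-⊨PL ds λ v ps → ⊩-⇒⁺ λ p → h v (p ∷ ps))

Δ-∨-absorb : ⊢M (φ ⇒ ψ) → ⊢M (Δ (φ ∨ᶠ ψ) ⇒ Δ ψ)
Δ-∨-absorb {φ} {ψ} d = ⊢M-⊨PL (REΔ (⊢M-⊨PL (d ∷ []) absorb) ∷ []) λ { _ (p ∷ []) → proj₁ (⊩-∧⁻ p) }
  where
  absorb : ((φ ⇒ ψ) ∷ []) ⊨PL φ ∨ᶠ ψ ⇔ ψ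
  absorb _ (p ∷ []) = ⊩-∧⁺ (⊩-⇒⁺ λ q → [ ⊩-⇒⁻ p , id ]′ (⊩-∨⁻ q)) (⊩-⇒⁺ ⊩-∨⁺ʳ)

⊢-theorem : ⊢M φ → Γ ⊢ φ
⊢-theorem d = [] , [] , ⊢M-⊨PL (d ∷ []) λ { _ (p ∷ []) → ⊩-⇒⁺ λ _ → p }

⊢-∈ : Γ φ → Γ ⊢ φ
⊢-∈ γ = _ ∷ [] , γ ∷ [] , ⊢M-⊨PL [] λ _ _ → ⊩-⇒⁺ (proj₁ ∘ ⊩-∧⁻)

⊢-mp : Γ ⊢ φ → Γ ⊢ (φ ⇒ ψ) → Γ ⊢ ψ
⊢-mp (l₁ , as₁ , d₁) (l₂ , as₂ , d₂) = l₁ ++ l₂ , ++⁺ as₁ as₂ , ⊢M-⊨PL (d₁ ∷ d₂ ∷ []) λ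
  { _ (p ∷ q ∷ []) → ⊩-⇒⁺ λ r → let rs = ⊩-⋀⁻ (l₁ ++ l₂) r in
      ⊩-⇒⁻ (⊩-⇒⁻ q (⊩-⋀⁺ (++⁻ʳ l₁ rs))) (⊩-⇒⁻ p (⊩-⋀⁺ (++⁻ˡ l₁ rs))) }

⊢-⊨PL : ∀ {ψs} → All (Γ ⊢_) ψs → ψs ⊨PL φ → Γ ⊢ φ
⊢-⊨PL []       h = ⊢-theorem (⊢M-⊨PL [] h)
⊢-⊨PL (d ∷ ds) h = ⊢-mp d (⊢-⊨PL ds λ v ps → ⊩-⇒⁺ λ p → h v (p ∷ ps))

⊢-deduction : (Γ ∪ ｛ ψ ｝) ⊢ φ → Γ ⊢ (ψ ⇒ φ)
⊢-deduction {Γ} {ψ} (l , as , d) = discharge l as d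
  where
  discharge : ∀ {φ} l → All (Γ ∪ ｛ ψ ｝) l → ⊢M (⋀ l ⇒ φ) → Γ ⊢ (ψ ⇒ φ)
  discharge [] [] d = ⊢-theorem (⊢M-⊨PL (d ∷ []) λ
    { _ (p ∷ []) → ⊩-⇒⁺ λ _ → ⊩-⇒⁻ p ⊩-⊤ })
  discharge {φ} (χ ∷ l) (a ∷ as) d = ⊢-⊨PL (ψ⇒χ a ∷ discharge l as curried ∷ []) λ
    { _ (p ∷ q ∷ []) → ⊩-⇒⁺ λ r → ⊩-⇒⁻ (⊩-⇒⁻ q r) (⊩-⇒⁻ p r) }
    where
    curried : ⊢M (⋀ l ⇒ χ ⇒ φ)
    curried = ⊢M-⊨PL (d ∷ []) λ { _ (p ∷ []) → ⊩-⇒⁺ λ q → ⊩-⇒⁺ λ r → ⊩-⇒⁻ p (⊩-∧⁺ r q) }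
    ψ⇒χ : (Γ ∪ ｛ ψ ｝) χ → Γ ⊢ (ψ ⇒ χ)
    ψ⇒χ (inj₁ γ)    = ⊢-⊨PL (⊢-∈ γ ∷ []) λ { _ (p ∷ []) → ⊩-⇒⁺ λ _ → p }
    ψ⇒χ (inj₂ refl) = ⊢-theorem (⊢M-⊨PL [] λ _ _ → ⊩-⇒⁺ id)

⊥ᶠ : Form
⊥ᶠ = ~ ⊤ᶠ

Consistent : Pred Form 0ℓ → Set
Consistent Γ = ¬ (Γ ⊢ ⊥ᶠ)

⊥-intro : Γ ⊢ φ → Γ ⊢ (~ φ) → Γ ⊢ ⊥ᶠ
⊥-intro d e = ⊢-⊨PL (d ∷ e ∷ []) λ { _ (p ∷ q ∷ []) → ⊥-elim (⊩-~⁻ q p) }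

⊢-by-contradiction : (Γ ∪ ｛ ~ φ ｝) ⊢ ⊥ᶠ → Γ ⊢ φ
⊢-by-contradiction d = ⊢-⊨PL (⊢-deduction d ∷ []) λ
  { _ (p ∷ []) → ⊩-stable λ ¬q → ⊩-~⁻ (⊩-⇒⁻ p (⊩-~⁺ ¬q)) ⊩-⊤ }

⊥-by-cases : (Γ ∪ ｛ ψ ｝) ⊢ ⊥ᶠ → (Γ ∪ ｛ ~ ψ ｝) ⊢ ⊥ᶠ → Γ ⊢ ⊥ᶠ
⊥-by-cases d e = ⊢-mp (⊢-by-contradiction e) (⊢-deduction d)

-- Soundness

supplemented-cong : ∀ {ℓ} (F : Frame ℓ) → Supplemented F →
  ∀ s {X Y} → (∀ t → X t ≡ Y t) → Frame.N F s X ≡ Frame.N F s Y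
supplemented-cong F supp s X≗Y =
  ≡true-ext (λ e → supp s _ _ e λ t → trans (sym (X≗Y t)))
            (λ e → supp s _ _ e λ t → trans (X≗Y t))

module Soundness {ℓ} (M : Model ℓ) (supp : Supplemented (Model.frame M)) where
  open Model M

  val : S → Form → Bool
  val s φ = ⟦_⟧ {M = M} φ s

  val-evalPL : ∀ φ s → val s φ ≡ evalPL (val s) φ
  val-evalPL (var p)  s = refl
  val-evalPL (~ φ)    s = cong not (val-evalPL φ s)
  val-evalPL (φ ∧ᶠ ψ) s = cong₂ _∧_ (val-evalPL φ s) (val-evalPL ψ s)
  val-evalPL (Δ φ)    s = refl

  ⊨⇒⊩ : ∀ φ {s} → M , s ⊨ φ → val s ⊩ φ
  ⊨⇒⊩ φ {s} e = mk⊩ (trans (sym (val-evalPL φ s)) e)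

  ⊩⇒⊨ : ∀ φ {s} → val s ⊩ φ → M , s ⊨ φ
  ⊩⇒⊨ φ {s} p = trans (val-evalPL φ s) (eval≡true p)

  N-cong : ∀ s {X Y} → (∀ t → X t ≡ Y t) → N s X ≡ N s Y
  N-cong = supplemented-cong frame supp

  Δ-true⁻ : ∀ {s} φ → val s ⊩ Δ φ → N s (λ t → val t φ) ≡ true ⊎ N s (λ t → val t (~ φ)) ≡ true
  Δ-true⁻ {s} φ p = ∨-true⁻ (N s (λ t → val t φ)) (eval≡true p)

  Δ-true⁺ : ∀ {s} φ → N s (λ t → val t φ) ≡ true → val s ⊩ Δ φ
  Δ-true⁺ φ e = mk⊩ (∨-true⁺ˡ e)

  N-mono-∨ : ∀ {s} φ ψ → N s (λ t → val t φ) ≡ true → N s (λ t → val t (φ ∨ᶠ ψ)) ≡ true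
  N-mono-∨ {s} φ ψ e = supp s _ _ e λ t p → ⊩⇒⊨ (φ ∨ᶠ ψ) (⊩-∨⁺ˡ (⊨⇒⊩ φ p))

  sound : ⊢M φ → ∀ s → val s ⊩ φ
  sound (TAUT t)      s = mk⊩ (t (val s))
  sound (MP d e)      s = ⊩-⇒⁻ (sound e s) (sound d s)
  sound (ΔM φ ψ χ)    s = ⊩-⇒⁺ λ p →
    [ ⊩-∨⁺ˡ ∘ Δ-true⁺ (φ ∨ᶠ ψ) ∘ N-mono-∨ φ ψ
    , ⊩-∨⁺ʳ ∘ Δ-true⁺ (~ φ ∨ᶠ χ) ∘ N-mono-∨ (~ φ) χ ]′ (Δ-true⁻ φ p)
  sound (ΔEqu φ)      s = ⊩-⇔⁺ (begin
    N s φ̂ ∨ N s (not ∘ φ̂)          ≡⟨ ∨-comm (N s φ̂) _ ⟩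
    N s (not ∘ φ̂) ∨ N s φ̂          ≡⟨ cong (N s (not ∘ φ̂) ∨_) (N-cong s λ t → sym (not-involutive (φ̂ t))) ⟩
    N s (not ∘ φ̂) ∨ N s (not ∘ not ∘ φ̂) ∎)
    where
    open ≡-Reasoning
    φ̂ : S → Bool
    φ̂ t = val t φ
  sound (REΔ {φ} {ψ} d) s = ⊩-⇔⁺ (cong₂ _∨_ (N-cong s φ≗ψ) (N-cong s (cong not ∘ φ≗ψ)))
    where
    φ≗ψ : ∀ t → val t φ ≡ val t ψ
    φ≗ψ t = trans (val-evalPL φ t) (trans (⊩-⇔⁻ (sound d t)) (sym (val-evalPL ψ t)))

soundness : ∀ ℓ → Sound ℓ
soundness ℓ φ d M supp s = ⊩⇒⊨ φ (sound d s)
  where open Soundness M supp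

-- Coding formulas by natural numbers

-- ℕᵇ is read as a list of bits 2[1+_] and 1+[2_]; the encoding is prefix-free.
unaryᵇ : ℕ → ℕᵇ → ℕᵇ
unaryᵇ zero    = 2[1+_]
unaryᵇ (suc n) = 1+[2_] ∘ unaryᵇ n

encode : Form → ℕᵇ → ℕᵇ
encode (var p)  = 2[1+_] ∘ 2[1+_] ∘ unaryᵇ p
encode (~ φ)    = 2[1+_] ∘ 1+[2_] ∘ encode φ
encode (φ ∧ᶠ ψ) = 1+[2_] ∘ 2[1+_] ∘ encode φ ∘ encode ψ
encode (Δ φ)    = 1+[2_] ∘ 1+[2_] ∘ encode φ

unaryᵇ-injective : ∀ m n {r s} → unaryᵇ m r ≡ unaryᵇ n s → m ≡ n × r ≡ s
unaryᵇ-injective zero    zero    e = refl , 2[1+_]-injective e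
unaryᵇ-injective (suc m) (suc n) e with unaryᵇ-injective m n (1+[2_]-injective e)
... | refl , refl = refl , refl
unaryᵇ-injective zero    (suc _) ()
unaryᵇ-injective (suc _) zero    ()

encode-injective : ∀ φ ψ {r s} → encode φ r ≡ encode ψ s → φ ≡ ψ × r ≡ s
encode-injective (var p) (var q) e
  with unaryᵇ-injective p q (2[1+_]-injective (2[1+_]-injective e))
... | refl , refl = refl , refl
encode-injective (~ φ) (~ ψ) e
  with encode-injective φ ψ (1+[2_]-injective (2[1+_]-injective e))
... | refl , refl = refl , refl
encode-injective (φ₁ ∧ᶠ φ₂) (ψ₁ ∧ᶠ ψ₂) e
  with encode-injective φ₁ ψ₁ (2[1+_]-injective (1+[2_]-injective e))
... | refl , e₂ with encode-injective φ₂ ψ₂ e₂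
...   | refl , refl = refl , refl
encode-injective (Δ φ) (Δ ψ) e
  with encode-injective φ ψ (1+[2_]-injective (1+[2_]-injective e))
... | refl , refl = refl , refl
encode-injective (var _)  (~ _)    ()
encode-injective (var _)  (_ ∧ᶠ _) ()
encode-injective (var _)  (Δ _)    ()
encode-injective (~ _)    (var _)  ()
encode-injective (~ _)    (_ ∧ᶠ _) ()
encode-injective (~ _)    (Δ _)    ()
encode-injective (_ ∧ᶠ _) (var _)  ()
encode-injective (_ ∧ᶠ _) (~ _)    ()
encode-injective (_ ∧ᶠ _) (Δ _)    ()
encode-injective (Δ _)    (var _)  ()
encode-injective (Δ _)    (~ _)    ()
encode-injective (Δ _)    (_ ∧ᶠ _) ()

code : Form → ℕ
code φ = toℕ (encode φ 0ᵇ)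

code-injective : code φ ≡ code ψ → φ ≡ ψ
code-injective {φ} {ψ} = proj₁ ∘ encode-injective φ ψ ∘ toℕ-injective

-- Maximal consistent sets

-- A maximal consistent set is determined by which variables and Δ-formulas it
-- contains: it contains φ iff this valuation of the atoms satisfies φ.
record MCS : Set where
  field
    valuation : Form → Bool
    theorems  : ⊢M φ → valuation ⊩ φ
open MCS

_∋_ : MCS → Form → Set
m ∋ φ = valuation m ⊩ φ

Complete : Pred Form 0ℓ → Set
Complete Γ = ∀ φ → Γ φ ⊎ Γ (~ φ)

module CompleteTheory (lem : ExcludedMiddle 0ℓ)
  {Γ : Pred Form 0ℓ} (consistent : Consistent Γ) (complete : Complete Γ) where

  closed : Γ ⊢ φ → Γ φ
  closed {φ} d with complete φ
  ... | inj₁ γ = γ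
  ... | inj₂ γ = ⊥-elim (consistent (⊥-intro d (⊢-∈ γ)))

  membership : Form → Bool
  membership φ = does (lem {Γ φ})

  mutual
    ⊩⇒∈ : ∀ φ → membership ⊩ φ → Γ φ
    ⊩⇒∈ (var p)  (mk⊩ e) = dec-true⁻ lem e
    ⊩⇒∈ (Δ φ)    (mk⊩ e) = dec-true⁻ lem e
    ⊩⇒∈ (~ φ)    p with complete φ
    ... | inj₁ γ = ⊥-elim (⊩-~⁻ p (∈⇒⊩ φ γ))
    ... | inj₂ γ = γ
    ⊩⇒∈ (φ ∧ᶠ ψ) p = closed (⊢-⊨PL (⊢-∈ (⊩⇒∈ φ p₁) ∷ ⊢-∈ (⊩⇒∈ ψ p₂) ∷ []) λ
      { _ (q ∷ r ∷ []) → ⊩-∧⁺ q r })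
      where
      p₁ : membership ⊩ φ
      p₁ = proj₁ (⊩-∧⁻ p)
      p₂ : membership ⊩ ψ
      p₂ = proj₂ (⊩-∧⁻ p)

    ∈⇒⊩ : ∀ φ → Γ φ → membership ⊩ φ
    ∈⇒⊩ (var p)  γ = mk⊩ (dec-true lem γ)
    ∈⇒⊩ (Δ φ)    γ = mk⊩ (dec-true lem γ)
    ∈⇒⊩ (~ φ)    γ = ⊩-~⁺ λ p → consistent (⊥-intro (⊢-∈ (⊩⇒∈ φ p)) (⊢-∈ γ))
    ∈⇒⊩ (φ ∧ᶠ ψ) γ = ⊩-∧⁺
      (∈⇒⊩ φ (closed (⊢-⊨PL (⊢-∈ γ ∷ []) λ { _ (p ∷ []) → proj₁ (⊩-∧⁻ p) })))
      (∈⇒⊩ ψ (closed (⊢-⊨PL (⊢-∈ γ ∷ []) λ { _ (p ∷ []) → proj₂ (⊩-∧⁻ p) })))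

  mcs : MCS
  mcs = record
    { valuation = membership
    ; theorems  = λ {φ} d → ∈⇒⊩ φ (closed (⊢-theorem d)) }

module Lindenbaum (lem : ExcludedMiddle 0ℓ) (Γ : Pred Form 0ℓ) (Γ-consistent : Consistent Γ) where

  extend : Pred Form 0ℓ → Form → Pred Form 0ℓ
  extend Θ ψ with lem {Consistent (Θ ∪ ｛ ψ ｝)}
  ... | yes _ = Θ ∪ ｛ ψ ｝
  ... | no _  = Θ ∪ ｛ ~ ψ ｝

  extend-⊇ : Θ ⊆ extend Θ ψ
  extend-⊇ {Θ} {ψ} θ with lem {Consistent (Θ ∪ ｛ ψ ｝)}
  ... | yes _ = inj₁ θ
  ... | no _  = inj₁ θ

  extend-consistent : Consistent Θ → Consistent (extend Θ ψ)
  extend-consistent {Θ} {ψ} con with lem {Consistent (Θ ∪ ｛ ψ ｝)}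
  ... | yes con′ = con′
  ... | no ¬con′ = λ d → ¬con′ λ d′ → con (⊥-by-cases d′ d)

  extend-decides : extend Θ ψ ψ ⊎ extend Θ ψ (~ ψ)
  extend-decides {Θ} {ψ} with lem {Consistent (Θ ∪ ｛ ψ ｝)}
  ... | yes _ = inj₁ (inj₂ refl)
  ... | no _  = inj₂ (inj₂ refl)

  -- Stage n + 1 decides the formula with code n, if there is one.
  stage : ℕ → Pred Form 0ℓ
  stage zero    = Γ
  stage (suc n) with lem {∃[ ψ ] code ψ ≡ n}
  ... | yes (ψ , _) = extend (stage n) ψ
  ... | no _        = stage n

  stage-⊆-suc : ∀ n → stage n ⊆ stage (suc n)
  stage-⊆-suc n with lem {∃[ ψ ] code ψ ≡ n}
  ... | yes _ = extend-⊇
  ... | no _  = id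

  stage-mono : ∀ {m n} → m ≤′ n → stage m ⊆ stage n
  stage-mono ≤′-refl         = id
  stage-mono (≤′-step {n} p) = stage-⊆-suc n ∘ stage-mono p

  stage-consistent : ∀ n → Consistent (stage n)
  stage-consistent zero = Γ-consistent
  stage-consistent (suc n) with lem {∃[ ψ ] code ψ ≡ n}
  ... | yes _ = extend-consistent (stage-consistent n)
  ... | no _  = stage-consistent n

  stage-decides : ∀ ψ → stage (suc (code ψ)) ψ ⊎ stage (suc (code ψ)) (~ ψ)
  stage-decides ψ with lem {∃[ ψ′ ] code ψ′ ≡ code ψ}
  ... | no ∄ = ⊥-elim (∄ (ψ , refl))
  ... | yes (ψ′ , e) with code-injective {ψ′} {ψ} e
  ...   | refl = extend-decides

  limit : Pred Form 0ℓ
  limit = ⋃ ℕ stage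

  All-limit⇒All-stage : ∀ {l} → All limit l → ∃[ n ] All (stage n) l
  All-limit⇒All-stage []             = zero , []
  All-limit⇒All-stage ((k , θ) ∷ θs) with All-limit⇒All-stage θs
  ... | n , θs′ = k ⊔ n , stage-mono (≤⇒≤′ (m≤m⊔n k n)) θ
                        ∷ All.map (stage-mono (≤⇒≤′ (m≤n⊔m k n))) θs′

  limit-consistent : Consistent limit
  limit-consistent (l , θs , d) with All-limit⇒All-stage θs
  ... | n , θs′ = stage-consistent n (l , θs′ , d)

  limit-complete : Complete limit
  limit-complete ψ with stage-decides ψ
  ... | inj₁ θ = inj₁ (_ , θ)
  ... | inj₂ θ = inj₂ (_ , θ)

  open CompleteTheory lem limit-consistent limit-complete

  lindenbaum : Σ MCS λ m → Γ ⊆ (m ∋_)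
  lindenbaum = mcs , ∈⇒⊩ _ ∘ (zero ,_)

⊢-complete-for-MCS : ExcludedMiddle 0ℓ → (∀ m → Γ ⊆ (m ∋_) → m ∋ φ) → Γ ⊢ φ
⊢-complete-for-MCS {Γ} {φ} lem h with lem {Γ ⊢ φ}
... | yes d = d
... | no ¬d = ⊥-elim (⊩-~⁻ (Γ,~φ⊆m (inj₂ refl)) (h m (Γ,~φ⊆m ∘ inj₁)))
  where
  open Lindenbaum lem (Γ ∪ ｛ ~ φ ｝) (¬d ∘ ⊢-by-contradiction)
  m : MCS
  m = proj₁ lindenbaum
  Γ,~φ⊆m : (Γ ∪ ｛ ~ φ ｝) ⊆ (m ∋_)
  Γ,~φ⊆m = proj₂ lindenbaum

⊢M-complete-for-MCS : ExcludedMiddle 0ℓ → (∀ m → m ∋ φ) → ⊢M φ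
⊢M-complete-for-MCS lem h with ⊢-complete-for-MCS {Γ = ∅} lem (λ m _ → h m)
... | [] , [] , d = ⊢M-⊨PL (d ∷ []) λ { _ (p ∷ []) → ⊩-⇒⁻ p ⊩-⊤ }

-- The canonical model

module Canonical (lem : ExcludedMiddle 0ℓ) where

  record CanonicalNbhd (m : MCS) (X : Pred MCS 0ℓ) : Set where
    constructor canonicalNbhd
    field
      witness     : Form
      witness-⊆   : (_∋ witness) ⊆ X
      Δ-witness-∨ : ∀ ψ → m ∋ Δ (witness ∨ᶠ ψ)

  CanonicalNbhd-mono : ∀ {m} {X Y : Pred MCS 0ℓ} → X ⊆ Y → CanonicalNbhd m X → CanonicalNbhd m Y
  CanonicalNbhd-mono X⊆Y (canonicalNbhd φ φ⊆X Δ∨) = canonicalNbhd φ (X⊆Y ∘ φ⊆X) Δ∨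

  CanonicalNbhd-of-Δ : ∀ {m} → m ∋ Δ φ → CanonicalNbhd m (_∋ φ) ⊎ CanonicalNbhd m (_∋ ~ φ)
  CanonicalNbhd-of-Δ {φ} {m} p with lem {∀ ψ → m ∋ Δ (φ ∨ᶠ ψ)}
  ... | yes Δφ∨ = inj₁ (canonicalNbhd φ id Δφ∨)
  ... | no ¬Δφ∨ = inj₂ (canonicalNbhd (~ φ) id λ χ → ⊩-stable λ ¬Δ~φ∨χ → ¬Δφ∨ λ ψ →
          [ id , ⊥-elim ∘ ¬Δ~φ∨χ ]′ (⊩-∨⁻ (⊩-⇒⁻ (theorems m (ΔM φ ψ χ)) p)))

  Δ-of-CanonicalNbhd : ∀ {m} → CanonicalNbhd m (_∋ φ) → m ∋ Δ φ
  Δ-of-CanonicalNbhd {φ} {m} (canonicalNbhd φ₀ φ₀⊆φ Δφ₀∨) =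
    ⊩-⇒⁻ (theorems m (Δ-∨-absorb (⊢M-complete-for-MCS lem λ t → ⊩-⇒⁺ (φ₀⊆φ {t})))) (Δφ₀∨ φ)

  Δ-of-CanonicalNbhd-⊎ : ∀ {m} → CanonicalNbhd m (_∋ φ) ⊎ CanonicalNbhd m (_∋ ~ φ) → m ∋ Δ φ
  Δ-of-CanonicalNbhd-⊎ (inj₁ nbhd) = Δ-of-CanonicalNbhd nbhd
  Δ-of-CanonicalNbhd-⊎ {φ} {m} (inj₂ nbhd) =
    ⊩-⇒⁻ (proj₂ (⊩-∧⁻ (theorems m (ΔEqu φ)))) (Δ-of-CanonicalNbhd nbhd)

  canonicalModel : ∀ ℓ → MCS → Model ℓ
  canonicalModel ℓ m₀ = record
    { frame = record
      { S  = Lift ℓ MCS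
      ; s₀ = lift m₀
      ; N  = λ s X → does (lem {CanonicalNbhd (lower s) (λ t → X (lift t) ≡ true)})
      }
    ; V = λ p s → valuation (lower s) (var p)
    }

  module _ {ℓ : Level} {m₀ : MCS} where
    open Model (canonicalModel ℓ m₀)

    canonical-supplemented : Supplemented frame
    canonical-supplemented _ _ _ e X⊆Y =
      dec-true lem (CanonicalNbhd-mono (λ {t} → X⊆Y (lift t)) (dec-true⁻ lem e))

    truth-lemma : ∀ φ m → ⟦_⟧ {M = canonicalModel ℓ m₀} φ (lift m) ≡ evalPL (valuation m) φ
    truth-lemma (var p)  m = refl
    truth-lemma (~ φ)    m = cong not (truth-lemma φ m)
    truth-lemma (φ ∧ᶠ ψ) m = cong₂ _∧_ (truth-lemma φ m) (truth-lemma ψ m)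
    truth-lemma (Δ φ)    m = does-∨≡ lem lem
      (eval≡true ∘ Δ-of-CanonicalNbhd-⊎ ∘ ⊎-map (CanonicalNbhd-mono ⟦φ⟧⊆φ) (CanonicalNbhd-mono ⟦~φ⟧⊆~φ))
      (⊎-map (CanonicalNbhd-mono φ⊆⟦φ⟧) (CanonicalNbhd-mono ~φ⊆⟦~φ⟧) ∘ CanonicalNbhd-of-Δ ∘ mk⊩)
      where
      ⟦φ⟧ : MCS → Bool
      ⟦φ⟧ t = ⟦_⟧ {M = canonicalModel ℓ m₀} φ (lift t)
      φ⊆⟦φ⟧ : (_∋ φ) ⊆ (λ t → ⟦φ⟧ t ≡ true)
      φ⊆⟦φ⟧ {t} p = trans (truth-lemma φ t) (eval≡true p)
      ⟦φ⟧⊆φ : (λ t → ⟦φ⟧ t ≡ true) ⊆ (_∋ φ)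
      ⟦φ⟧⊆φ {t} e = mk⊩ (trans (sym (truth-lemma φ t)) e)
      ~φ⊆⟦~φ⟧ : (_∋ ~ φ) ⊆ (λ t → not (⟦φ⟧ t) ≡ true)
      ~φ⊆⟦~φ⟧ {t} p = trans (cong not (truth-lemma φ t)) (eval≡true p)
      ⟦~φ⟧⊆~φ : (λ t → not (⟦φ⟧ t) ≡ true) ⊆ (_∋ ~ φ)
      ⟦~φ⟧⊆~φ {t} e = mk⊩ (trans (sym (cong not (truth-lemma φ t))) e)

strong-completeness : ExcludedMiddle 0ℓ → ∀ ℓ → StronglyComplete ℓ
strong-completeness lem ℓ Γ φ Γ⊨φ = ⊢-complete-for-MCS lem φ-in-every-extension
  where
  open Canonical lem
  φ-in-every-extension : ∀ m → Γ ⊆ (m ∋_) → m ∋ φ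
  φ-in-every-extension m Γ⊆m = mk⊩ (begin
    evalPL (valuation m) φ                 ≡⟨ truth-lemma {m₀ = m} φ m ⟨
    ⟦_⟧ {M = canonicalModel ℓ m} φ (lift m) ≡⟨ Γ⊨φ (canonicalModel ℓ m) (canonical-supplemented {m₀ = m}) (lift m)
                                                (λ ψ γ → trans (truth-lemma {m₀ = m} ψ m) (eval≡true (Γ⊆m γ))) ⟩
    true                                   ∎)
    where open ≡-Reasoning

mainTheorem1 : ExcludedMiddle 0ℓ → ∀ ℓ → Sound ℓ × StronglyComplete ℓ
mainTheorem1 lem ℓ = soundness ℓ , strong-completeness lem ℓ
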